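{- Consider the online maximum $k$-interval coverage problem in the FL-AN setting with quota $k\ge 2$ and known maximum length $m>1$. Then no online deterministic algorithm can achieve a competitive ratio better than $\frac{2m}{m+1}$, which is strictly smaller than $2$.
   Context: Online maximum $k$-interval coverage problem: there is a target interval $[0,a]$ (part of the instance). Sub-intervals $V_1,V_2,\dots$ with $V_i=[o_i,d_i]\subseteq[0,a]$ are released one at a time in an adversarial order. On the release of $V_i$ the algorithm must immediately and irrevocably accept or reject it, without knowledge of future sub-intervals. At most $k$ sub-intervals may be accepted. For a set $U$ of sub-intervals let $Len(U)=|\bigcup_{V\in U}V|$; the goal is to maximize $Len(U)$ for the accepted set $U$. $\mathrm{ALG}(\mathbb{V})$ is the value obtained by ALG on instance $\mathbb{V}$, $\mathrm{OPT}(\mathbb{V})$ the maximum of $Len(U)$ over $U\subseteq\mathbb{V}$, $|U|\le k$. ALG is $\rho$-competitive if $\mathrm{OPT}(\mathbb{V})\le\rho\,\mathrm{ALG}(\mathbb{V})$ for all instances. FL-AN setting: every released sub-interval has length in $[1,m]$ for a known constant $m>1$, and the total number of released sub-intervals is not known in advance.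
   Formalization: The known maximum length m and the competitive ratio ρ range over the rationals, and the endpoints of the target interval and of all sub-intervals are taken in ℚ. -}

module Defs where

open import Data.Bool using (Bool; true; false; if_then_else_)
open import Data.Nat as ℕ using (ℕ; zero; suc)
open import Data.List using (List; []; _∷_; map; length; foldr; _++_; filterᵇ)
open import Data.Product using (_×_; _,_; proj₁; proj₂)
open import Data.Rational using (ℚ; 0ℚ; 1ℚ; _+_; _-_; _*_; _⊔_; _⊓_; _≤_; _<_)
open import Data.List.Relation.Unary.All using (All)
open import Relation.Nullary using (¬_)

Interval : Set
Interval = ℚ × ℚ

left right : Interval → ℚ
left  = proj₁
right = proj₂

len : Interval → ℚ
len I = 0ℚ ⊔ (right I - left I)

_∩_ : Interval → Interval → Interval
I ∩ J = (left I ⊔ left J , right I ⊓ right J)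

-- Measure of the union of a list of intervals, by inclusion–exclusion
--   |I ∪ S| = |I| + |S| - |⋃_{J ∈ S} (I ∩ J)|,
-- with fuel (the list length) to make the recursion structural.
lenFuel : ℕ → List Interval → ℚ
lenFuel zero    _       = 0ℚ
lenFuel (suc n) []      = 0ℚ
lenFuel (suc n) (I ∷ U) = (len I + lenFuel n U) - lenFuel n (map (I ∩_) U)

Len : List Interval → ℚ
Len U = lenFuel (length U) U

subsets : List Interval → List (List Interval)
subsets []      = [] ∷ []
subsets (I ∷ U) = let S = subsets U in S ++ map (I ∷_) S

maxℚ : List ℚ → ℚ
maxℚ = foldr _⊔_ 0ℚ

OPT : ℕ → List Interval → ℚ
OPT k V = maxℚ (map Len (filterᵇ (λ U → length U ℕ.≤ᵇ k) (subsets V)))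

-- A deterministic online algorithm: given the target interval endpoint a,
-- the list of previously released sub-intervals (in release order) and the
-- newly released sub-interval, it decides accept (true) / reject (false).
-- It sees nothing about future releases nor their number.
OnlineAlg : Set
OnlineAlg = (a : ℚ) → (history : List Interval) → (new : Interval) → Bool

run : ℕ → OnlineAlg → ℚ → (history : List Interval) → (accepted : ℕ) →
      (future : List Interval) → List Interval
run k A a h c []      = []
run k A a h c (I ∷ F) with A a h I | c ℕ.<ᵇ k
... | true  | true = I ∷ run k A a (h ++ I ∷ []) (suc c) F
... | _     | _    = run k A a (h ++ I ∷ []) c F

ALG : ℕ → OnlineAlg → ℚ → List Interval → ℚ
ALG k A a V = Len (run k A a [] 0 V)

ValidInterval : ℚ → ℚ → Interval → Set
ValidInterval m a I =
  (0ℚ ≤ left I) × (right I ≤ a) × (1ℚ ≤ right I - left I) × (right I - left I ≤ m)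

ValidInstance : ℚ → ℚ → List Interval → Set
ValidInstance m a V = All (ValidInterval m a) V

Competitive : ℕ → ℚ → OnlineAlg → ℚ → Set
Competitive k m A ρ =
  ∀ (a : ℚ) (V : List Interval) → ValidInstance m a V → OPT k V ≤ ρ * ALG k A a V

2ℚ : ℚ
2ℚ = 1ℚ + 1ℚ

-- The adversary releases k unit intervals spaced m apart, then k further
-- disjoint intervals of length m. If the algorithm keeps x of the units, the
-- instance may end after the first phase, where OPT = k ≤ ρx; otherwise
-- OPT ≥ km, while with only k − x slots left the algorithm covers at most
-- x + (k − x)m. Eliminating x yields ρm ≥ 2m − 1, which for m > 1 implies
-- 2m ≤ ρ(m + 1).
module Submission where

open import Defs
open import Data.Nat using (ℕ)
open import Data.Product using (_×_)
open import Data.Rational using (ℚ; 1ℚ; _+_; _*_; _<_; _≤_)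
open import Relation.Nullary using (¬_)

open import Data.Bool using (true; false; T)
open import Data.Nat as ℕ using (zero; suc)
import Data.Nat.Properties as ℕ
open import Data.Rational using (0ℚ; _-_; -_; positive; nonNegative)
open import Data.Rational.Properties
open import Data.Rational.Solver using (module +-*-Solver)
open import Data.Product using (_,_)
open import Data.Sum using (inj₁; inj₂)
open import Data.Empty using (⊥-elim)
open import Data.List using (List; []; _∷_; map; length; foldr; _++_)
open import Data.List.Properties using (++-assoc; ++-identityʳ; length-++)
open import Data.List.Relation.Unary.All as All using (All; []; _∷_)
import Data.List.Relation.Unary.All.Properties as All
open import Data.List.Relation.Unary.AllPairs using (AllPairs; []; _∷_)
import Data.List.Relation.Unary.AllPairs.Properties as AllPairs
open import Data.List.Relation.Unary.Any using (here; there)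
open import Data.List.Relation.Binary.Sublist.Propositional using (_⊆_; []; _∷_; _∷ʳ_; ⊆-refl)
open import Data.List.Relation.Binary.Sublist.Propositional.Properties
  using (All-resp-⊆; ++⁺ˡ)
open import Data.List.Membership.Propositional using (_∈_)
open import Data.List.Membership.Propositional.Properties using (∈-map⁺; ∈-++⁺ˡ; ∈-++⁺ʳ; ∈-filter⁺)
open import Relation.Nullary.Decidable using (T?)
open import Relation.Binary.PropositionalEquality
open +-*-Solver

p≤q⇒0≤q-p : ∀ {p q} → p ≤ q → 0ℚ ≤ q - p
p≤q⇒0≤q-p {p} {q} p≤q = subst (_≤ q - p) (+-inverseʳ p) (+-monoˡ-≤ (- p) p≤q)

p<q⇒0<q-p : ∀ {p q} → p < q → 0ℚ < q - p
p<q⇒0<q-p {p} {q} p<q = subst (_< q - p) (+-inverseʳ p) (+-monoˡ-< (- p) p<q)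

p≤p+q : ∀ p {q} → 0ℚ ≤ q → p ≤ p + q
p≤p+q p {q} 0≤q = subst (_≤ p + q) (+-identityʳ p) (+-monoʳ-≤ p 0≤q)

+-nonNeg : ∀ {p q} → 0ℚ ≤ p → 0ℚ ≤ q → 0ℚ ≤ p + q
+-nonNeg 0≤p 0≤q = ≤-trans 0≤p (p≤p+q _ 0≤q)

*-nonNeg : ∀ {p q} → 0ℚ ≤ p → 0ℚ ≤ q → 0ℚ ≤ p * q
*-nonNeg {p} {q} 0≤p 0≤q = subst (_≤ p * q) (*-zeroʳ p) (*-monoˡ-≤-nonNeg p {{nonNegative 0≤p}} 0≤q)

*-pos : ∀ {p q} → 0ℚ < p → 0ℚ < q → 0ℚ < p * q
*-pos {p} {q} 0<p 0<q = subst (_< p * q) (*-zeroʳ p) (*-monoʳ-<-pos p {{positive 0<p}} 0<q)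

0<1 : 0ℚ < 1ℚ
0<1 = positive⁻¹ 1ℚ

nonNeg-factor : ∀ {ρ x} → 0ℚ ≤ x → 0ℚ < ρ * x → 0ℚ ≤ ρ
nonNeg-factor {ρ} {x} 0≤x 0<ρx with ≤-total 0ℚ ρ
... | inj₁ 0≤ρ = 0≤ρ
... | inj₂ ρ≤0 = ⊥-elim (<-irrefl refl (<-≤-trans 0<ρx ρx≤0))
  where
  ρx≤0 : ρ * x ≤ 0ℚ
  ρx≤0 = subst (ρ * x ≤_) (*-zeroˡ x) (*-monoʳ-≤-nonNeg x {{nonNegative 0≤x}} ρ≤0)

-- For the slacks a = ρx − K, b = ρ(x + ym) − Km, c = K − (x + y) one has
-- b + ρm·c + (m − 1)·a = K(ρm − 2m + 1); multiplying by m + 1 and adding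
-- Km(2m − ρ(m + 1)) + K(m − 1) gives the identity below, whose left side
-- would be positive if ρ(m + 1) < 2m.
ratio-bound : ∀ {ρ x y K m} → 0ℚ ≤ x → 0ℚ < K → 1ℚ < m →
              K ≤ ρ * x → K * m ≤ ρ * (x + y * m) → x + y ≤ K →
              2ℚ * m ≤ ρ * (m + 1ℚ)
ratio-bound {ρ} {x} {y} {K} {m} 0≤x 0<K 1<m K≤ρx Km≤ρ[x+ym] x+y≤K = ≮⇒≥ impossible
  where
  0≤ρ : 0ℚ ≤ ρ
  0≤ρ = nonNeg-factor 0≤x (<-≤-trans 0<K K≤ρx)
  0<m : 0ℚ < m
  0<m = <-trans 0<1 1<m
  0<m+1 : 0ℚ < m + 1ℚ
  0<m+1 = <-≤-trans 0<m (p≤p+q m (<⇒≤ 0<1))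
  P = (m + 1ℚ) * ((ρ * (x + y * m) - K * m) + (ρ * m) * (K - (x + y)) + (m - 1ℚ) * (ρ * x - K))
  Q = (K * m) * (2ℚ * m - ρ * (m + 1ℚ))
  R = K * (m - 1ℚ)
  certificate : P + Q + R ≡ 0ℚ
  certificate = solve 5 (λ ρ x y K m →
     ((m :+ con 1ℚ) :* (((ρ :* (x :+ y :* m)) :- K :* m) :+ (ρ :* m) :* (K :- (x :+ y))
                         :+ (m :- con 1ℚ) :* (ρ :* x :- K)))
     :+ (K :* m) :* ((con 1ℚ :+ con 1ℚ) :* m :- ρ :* (m :+ con 1ℚ)) :+ K :* (m :- con 1ℚ)
     := con 0ℚ) refl ρ x y K m
  impossible : ¬ ρ * (m + 1ℚ) < 2ℚ * m
  impossible ρ[m+1]<2m = <-irrefl (sym certificate) 0<P+Q+R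
    where
    0≤P : 0ℚ ≤ P
    0≤P = *-nonNeg (<⇒≤ 0<m+1)
            (+-nonNeg (+-nonNeg (p≤q⇒0≤q-p Km≤ρ[x+ym])
                                 (*-nonNeg (*-nonNeg 0≤ρ (<⇒≤ 0<m)) (p≤q⇒0≤q-p x+y≤K)))
                      (*-nonNeg (<⇒≤ (p<q⇒0<q-p 1<m)) (p≤q⇒0≤q-p K≤ρx)))
    0<Q : 0ℚ < Q
    0<Q = *-pos (*-pos 0<K 0<m) (p<q⇒0<q-p ρ[m+1]<2m)
    0≤R : 0ℚ ≤ R
    0≤R = *-nonNeg (<⇒≤ 0<K) (<⇒≤ (p<q⇒0<q-p 1<m))
    0<P+Q+R : 0ℚ < P + Q + R
    0<P+Q+R = +-mono-<-≤ (+-mono-≤-< 0≤P 0<Q) 0≤R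

fromℕ : ℕ → ℚ
fromℕ zero    = 0ℚ
fromℕ (suc n) = 1ℚ + fromℕ n

fromℕ-+ : ∀ a b → fromℕ (a ℕ.+ b) ≡ fromℕ a + fromℕ b
fromℕ-+ zero    b = sym (+-identityˡ (fromℕ b))
fromℕ-+ (suc a) b = trans (cong (1ℚ +_) (fromℕ-+ a b)) (sym (+-assoc 1ℚ (fromℕ a) (fromℕ b)))

fromℕ-nonNeg : ∀ n → 0ℚ ≤ fromℕ n
fromℕ-nonNeg zero    = ≤-refl
fromℕ-nonNeg (suc n) = +-nonNeg (<⇒≤ 0<1) (fromℕ-nonNeg n)

fromℕ-mono-≤ : ∀ {a b} → a ℕ.≤ b → fromℕ a ≤ fromℕ b
fromℕ-mono-≤ {zero}  {b}     _           = fromℕ-nonNeg b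
fromℕ-mono-≤ {suc a} {suc b} (ℕ.s≤s a≤b) = +-monoʳ-≤ 1ℚ (fromℕ-mono-≤ a≤b)

fromℕ-suc-pos : ∀ n → 0ℚ < fromℕ (suc n)
fromℕ-suc-pos n = <-≤-trans 0<1 (p≤p+q 1ℚ (fromℕ-nonNeg n))

Precedes : Interval → Interval → Set
Precedes I J = right I ≤ left J

Empty : Interval → Set
Empty I = right I ≤ left I

len-empty : ∀ {I} → Empty I → len I ≡ 0ℚ
len-empty {I} empty = p≥q⇒p⊔q≡p (subst (right I - left I ≤_) (+-inverseʳ (left I))
                                        (+-monoˡ-≤ (- left I) empty))

len-nonEmpty : ∀ {I} → 0ℚ ≤ right I - left I → len I ≡ right I - left I
len-nonEmpty = p≤q⇒p⊔q≡q

∩-empty : ∀ I {J} → Empty J → Empty (I ∩ J)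
∩-empty I {J} empty = ≤-trans (p⊓q≤q (right I) (right J)) (≤-trans empty (p≤q⊔p (left I) (left J)))

∩-precedes : ∀ {I J} → Precedes I J → Empty (I ∩ J)
∩-precedes {I} {J} I≺J = ≤-trans (p⊓q≤p (right I) (right J)) (≤-trans I≺J (p≤q⊔p (left I) (left J)))

lenFuel-empty : ∀ n {U} → All Empty U → lenFuel n U ≡ 0ℚ
lenFuel-empty zero    _                = refl
lenFuel-empty (suc n) []               = refl
lenFuel-empty (suc n) {I ∷ U} (e ∷ es)
  rewrite len-empty e | lenFuel-empty n es
        | lenFuel-empty n (All.map⁺ (All.map (∩-empty I) es)) = refl

sumLen : List Interval → ℚ
sumLen = foldr (λ I s → len I + s) 0ℚ

-- Inclusion–exclusion degenerates to a plain sum: every correction term is a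
-- union of empty intersections.
Len-sorted : ∀ {U} → AllPairs Precedes U → Len U ≡ sumLen U
Len-sorted []                  = refl
Len-sorted {I ∷ U} (I≺U ∷ sorted) = begin
  (len I + Len U) - lenFuel (length U) (map (I ∩_) U)
    ≡⟨ cong₂ (λ a b → (len I + a) - b) (Len-sorted sorted)
             (lenFuel-empty (length U) (All.map⁺ (All.map (∩-precedes {I}) I≺U))) ⟩
  (len I + sumLen U) - 0ℚ
    ≡⟨ +-identityʳ (len I + sumLen U) ⟩
  len I + sumLen U ∎
  where open ≡-Reasoning

sumLen-++ : ∀ U V → sumLen (U ++ V) ≡ sumLen U + sumLen V
sumLen-++ []      V = sym (+-identityˡ (sumLen V))
sumLen-++ (I ∷ U) V = trans (cong (len I +_) (sumLen-++ U V)) (sym (+-assoc (len I) _ _))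

sumLen-const : ∀ {w U} → All (λ I → len I ≡ w) U → sumLen U ≡ fromℕ (length U) * w
sumLen-const {w} []                    = sym (*-zeroˡ w)
sumLen-const {w} {I ∷ U} (lenI ∷ lens) = begin
  len I + sumLen U               ≡⟨ cong₂ _+_ lenI (sumLen-const lens) ⟩
  w + fromℕ (length U) * w       ≡⟨ solve 2 (λ w n → w :+ n :* w := (con 1ℚ :+ n) :* w) refl w (fromℕ (length U)) ⟩
  (1ℚ + fromℕ (length U)) * w    ∎
  where open ≡-Reasoning

AllPairs-resp-⊆ : ∀ {R : Interval → Interval → Set} {U V} → U ⊆ V → AllPairs R V → AllPairs R U
AllPairs-resp-⊆ []         []         = []
AllPairs-resp-⊆ (_ ∷ʳ U⊆V) (_ ∷ rs)   = AllPairs-resp-⊆ U⊆V rs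
AllPairs-resp-⊆ (refl ∷ U⊆V) (r ∷ rs) = All-resp-⊆ U⊆V r ∷ AllPairs-resp-⊆ U⊆V rs

module _ (k : ℕ) (A : OnlineAlg) (a : ℚ) where

  run-⊆ : ∀ h c F → run k A a h c F ⊆ F
  run-⊆ h c []      = []
  run-⊆ h c (I ∷ F) with A a h I | c ℕ.<ᵇ k
  ... | true  | true  = refl ∷ run-⊆ (h ++ I ∷ []) (suc c) F
  ... | true  | false = I ∷ʳ run-⊆ (h ++ I ∷ []) c F
  ... | false | _     = I ∷ʳ run-⊆ (h ++ I ∷ []) c F

  run-respects-quota : ∀ h c F → c ℕ.≤ k → c ℕ.+ length (run k A a h c F) ℕ.≤ k
  run-respects-quota h c []      c≤k rewrite ℕ.+-identityʳ c = c≤k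
  run-respects-quota h c (I ∷ F) c≤k with A a h I | c ℕ.<ᵇ k in c<ᵇk
  ... | true  | true  rewrite ℕ.+-suc c (length (run k A a (h ++ I ∷ []) (suc c) F)) =
    run-respects-quota (h ++ I ∷ []) (suc c) F (ℕ.<ᵇ⇒< c k (subst T (sym c<ᵇk) _))
  ... | true  | false = run-respects-quota (h ++ I ∷ []) c F c≤k
  ... | false | _     = run-respects-quota (h ++ I ∷ []) c F c≤k

  run-++ : ∀ h c P L → run k A a h c (P ++ L) ≡
           run k A a h c P ++ run k A a (h ++ P) (c ℕ.+ length (run k A a h c P)) L
  run-++ h c []      L rewrite ++-identityʳ h | ℕ.+-identityʳ c = refl
  run-++ h c (I ∷ P) L with A a h I | c ℕ.<ᵇ k
  ... | true  | true  rewrite run-++ (h ++ I ∷ []) (suc c) P L | ++-assoc h (I ∷ []) P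
                            | ℕ.+-suc c (length (run k A a (h ++ I ∷ []) (suc c) P)) = refl
  ... | true  | false rewrite run-++ (h ++ I ∷ []) c P L | ++-assoc h (I ∷ []) P = refl
  ... | false | _     rewrite run-++ (h ++ I ∷ []) c P L | ++-assoc h (I ∷ []) P = refl

⊆⇒∈-subsets : ∀ {U V} → U ⊆ V → U ∈ subsets V
⊆⇒∈-subsets []                           = here refl
⊆⇒∈-subsets {V = I ∷ V} (_ ∷ʳ U⊆V)   = ∈-++⁺ˡ (⊆⇒∈-subsets U⊆V)
⊆⇒∈-subsets {V = I ∷ V} (refl ∷ U⊆V) = ∈-++⁺ʳ (subsets V) (∈-map⁺ (I ∷_) (⊆⇒∈-subsets U⊆V))

≤-maxℚ : ∀ {q qs} → q ∈ qs → q ≤ maxℚ qs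
≤-maxℚ {q} (here refl) = p≤p⊔q q _
≤-maxℚ {qs = p ∷ _} (there q∈qs) = p≤q⇒p≤r⊔q p (≤-maxℚ q∈qs)

Len≤OPT : ∀ k {U V} → U ⊆ V → length U ℕ.≤ k → Len U ≤ OPT k V
Len≤OPT k U⊆V |U|≤k =
  ≤-maxℚ (∈-map⁺ Len (∈-filter⁺ (λ W → T? (length W ℕ.≤ᵇ k)) (⊆⇒∈-subsets U⊆V) (ℕ.≤⇒≤ᵇ |U|≤k)))

module Spacing (m : ℚ) (0≤m : 0ℚ ≤ m) where

  end : ℕ → ℚ → ℚ
  end zero    s = s
  end (suc n) s = end n (s + m)

  ≤-end : ∀ n s → s ≤ end n s
  ≤-end zero    s = ≤-refl
  ≤-end (suc n) s = ≤-trans (p≤p+q s 0≤m) (≤-end n (s + m))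

  module Width (w : ℚ) (0≤w : 0ℚ ≤ w) (w≤m : w ≤ m) where

    spaced : ℕ → ℚ → List Interval
    spaced zero    s = []
    spaced (suc n) s = (s , s + w) ∷ spaced n (s + m)

    Within : ℚ → ℚ → Interval → Set
    Within s e I = s ≤ left I × right I ≤ e × right I - left I ≡ w

    spaced-within : ∀ n s → All (Within s (end n s)) (spaced n s)
    spaced-within zero    s = []
    spaced-within (suc n) s =
      (≤-refl , ≤-trans (+-monoʳ-≤ s w≤m) (≤-end n (s + m)) , width)
      ∷ All.map (λ { (s+m≤o , d≤e , d-o≡w) → ≤-trans (p≤p+q s 0≤m) s+m≤o , d≤e , d-o≡w })
                (spaced-within n (s + m))
      where
      width : (s + w) - s ≡ w
      width = solve 2 (λ s w → (s :+ w) :- s := w) refl s w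

    spaced-sorted : ∀ n s → AllPairs Precedes (spaced n s)
    spaced-sorted zero    s = []
    spaced-sorted (suc n) s =
      All.map (λ (s+m≤o , _) → ≤-trans (+-monoʳ-≤ s w≤m) s+m≤o) (spaced-within n (s + m))
      ∷ spaced-sorted n (s + m)

    length-spaced : ∀ n s → length (spaced n s) ≡ n
    length-spaced zero    s = refl
    length-spaced (suc n) s = cong suc (length-spaced n (s + m))

    len-within : ∀ {s e I} → Within s e I → len I ≡ w
    len-within {I = I} (_ , _ , d-o≡w) = trans (len-nonEmpty {I} (subst (0ℚ ≤_) (sym d-o≡w) 0≤w)) d-o≡w

    sumLen-⊆-spaced : ∀ n s {R} → R ⊆ spaced n s → sumLen R ≡ fromℕ (length R) * w
    sumLen-⊆-spaced n s R⊆ = sumLen-const (All-resp-⊆ R⊆ (All.map len-within (spaced-within n s)))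

    Len-spaced : ∀ n s → Len (spaced n s) ≡ fromℕ n * w
    Len-spaced n s = begin
      Len (spaced n s)                    ≡⟨ Len-sorted (spaced-sorted n s) ⟩
      sumLen (spaced n s)                 ≡⟨ sumLen-⊆-spaced n s ⊆-refl ⟩
      fromℕ (length (spaced n s)) * w     ≡⟨ cong (λ l → fromℕ l * w) (length-spaced n s) ⟩
      fromℕ n * w                         ∎
      where open ≡-Reasoning

    spaced-valid : ∀ {a} n s → 1ℚ ≤ w → 0ℚ ≤ s → end n s ≤ a → ValidInstance m a (spaced n s)
    spaced-valid n s 1≤w 0≤s e≤a = All.map
      (λ (s≤o , d≤e , d-o≡w) → ≤-trans 0≤s s≤o , ≤-trans d≤e e≤a
                             , subst (1ℚ ≤_) (sym d-o≡w) 1≤w , subst (_≤ m) (sym d-o≡w) w≤m)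
      (spaced-within n s)

module Adversary (k′ : ℕ) (m : ℚ) (1<m : 1ℚ < m) (A : OnlineAlg) where

  k : ℕ
  k = suc k′

  1≤m : 1ℚ ≤ m
  1≤m = <⇒≤ 1<m

  0≤m : 0ℚ ≤ m
  0≤m = ≤-trans (<⇒≤ 0<1) 1≤m

  open Spacing m 0≤m
  module Units = Width 1ℚ (<⇒≤ 0<1) 1≤m
  module Longs = Width m 0≤m ≤-refl

  units longs : List Interval
  units = Units.spaced k 0ℚ
  longs = Longs.spaced k (end k 0ℚ)

  a : ℚ
  a = end k (end k 0ℚ)

  accepted₁ accepted₂ : List Interval
  accepted₁ = run k A a [] 0 units
  accepted₂ = run k A a units (length accepted₁) longs

  x y K : ℚ
  x = fromℕ (length accepted₁)
  y = fromℕ (length accepted₂)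
  K = fromℕ k

  valid-units : ValidInstance m a units
  valid-units = Units.spaced-valid k 0ℚ ≤-refl ≤-refl (≤-end k (end k 0ℚ))

  valid-all : ValidInstance m a (units ++ longs)
  valid-all = All.++⁺ valid-units (Longs.spaced-valid k (end k 0ℚ) 1≤m (≤-end k 0ℚ) ≤-refl)

  sorted : AllPairs Precedes (units ++ longs)
  sorted = AllPairs.++⁺ (Units.spaced-sorted k 0ℚ) (Longs.spaced-sorted k (end k 0ℚ))
    (All.map (λ (_ , d≤e , _) → All.map (λ (e≤o , _) → ≤-trans d≤e e≤o) (Longs.spaced-within k (end k 0ℚ)))
             (Units.spaced-within k 0ℚ))

  run-all : run k A a [] 0 (units ++ longs) ≡ accepted₁ ++ accepted₂
  run-all = run-++ k A a [] 0 units longs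

  accepted₁⊆units : accepted₁ ⊆ units
  accepted₁⊆units = run-⊆ k A a [] 0 units

  accepted₂⊆longs : accepted₂ ⊆ longs
  accepted₂⊆longs = run-⊆ k A a units (length accepted₁) longs

  ALG-units : ALG k A a units ≡ x
  ALG-units = begin
    Len accepted₁    ≡⟨ Len-sorted (AllPairs-resp-⊆ accepted₁⊆units (Units.spaced-sorted k 0ℚ)) ⟩
    sumLen accepted₁ ≡⟨ Units.sumLen-⊆-spaced k 0ℚ accepted₁⊆units ⟩
    x * 1ℚ           ≡⟨ *-identityʳ x ⟩
    x                ∎
    where open ≡-Reasoning

  ALG-all : ALG k A a (units ++ longs) ≡ x + y * m
  ALG-all = begin
    Len (run k A a [] 0 (units ++ longs))   ≡⟨ cong Len run-all ⟩
    Len (accepted₁ ++ accepted₂)            ≡⟨ Len-sorted (AllPairs-resp-⊆ accepted⊆ sorted) ⟩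
    sumLen (accepted₁ ++ accepted₂)         ≡⟨ sumLen-++ accepted₁ accepted₂ ⟩
    sumLen accepted₁ + sumLen accepted₂     ≡⟨ cong₂ _+_ (Units.sumLen-⊆-spaced k 0ℚ accepted₁⊆units)
                                                         (Longs.sumLen-⊆-spaced k (end k 0ℚ) accepted₂⊆longs) ⟩
    x * 1ℚ + y * m                          ≡⟨ cong (_+ y * m) (*-identityʳ x) ⟩
    x + y * m                               ∎
    where
    open ≡-Reasoning
    accepted⊆ : accepted₁ ++ accepted₂ ⊆ units ++ longs
    accepted⊆ = subst (_⊆ units ++ longs) run-all (run-⊆ k A a [] 0 (units ++ longs))

  OPT-units : K ≤ OPT k units
  OPT-units = subst (_≤ OPT k units) (trans (Units.Len-spaced k 0ℚ) (*-identityʳ K))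
    (Len≤OPT k {units} ⊆-refl (ℕ.≤-reflexive (Units.length-spaced k 0ℚ)))

  OPT-all : K * m ≤ OPT k (units ++ longs)
  OPT-all = subst (_≤ OPT k (units ++ longs)) (Longs.Len-spaced k (end k 0ℚ))
    (Len≤OPT k {longs} (++⁺ˡ units ⊆-refl) (ℕ.≤-reflexive (Longs.length-spaced k (end k 0ℚ))))

  quota : x + y ≤ K
  quota = subst (_≤ K) (fromℕ-+ (length accepted₁) (length accepted₂)) (fromℕ-mono-≤ (begin
    length accepted₁ ℕ.+ length accepted₂   ≡⟨ length-++ accepted₁ ⟨
    length (accepted₁ ++ accepted₂)          ≡⟨ cong length run-all ⟨
    length (run k A a [] 0 (units ++ longs)) ≤⟨ run-respects-quota k A a [] 0 (units ++ longs) ℕ.z≤n ⟩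
    k                                        ∎))
    where open ℕ.≤-Reasoning

Competitive⇒≤ : ∀ {k m} A ρ → Competitive k m A ρ → ∀ {a V q z} → ValidInstance m a V →
                q ≤ OPT k V → ALG k A a V ≡ z → q ≤ ρ * z
Competitive⇒≤ {k} A ρ competitive {a} {V} valid q≤OPT ALG≡z =
  ≤-trans q≤OPT (subst (λ z → OPT k V ≤ ρ * z) ALG≡z (competitive a V valid))

competitive⇒ratio-bound : ∀ {k} → 1 ℕ.≤ k → ∀ {m} → 1ℚ < m → ∀ A ρ → Competitive k m A ρ →
                          2ℚ * m ≤ ρ * (m + 1ℚ)
competitive⇒ratio-bound {suc k′} _ {m} 1<m A ρ competitive =
  ratio-bound {ρ} (fromℕ-nonNeg (length accepted₁)) (fromℕ-suc-pos k′) 1<m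
    (Competitive⇒≤ A ρ competitive valid-units OPT-units ALG-units)
    (Competitive⇒≤ A ρ competitive valid-all OPT-all ALG-all)
    quota
  where open Adversary k′ m 1<m A

corollary2 : (k : ℕ) → 2 Data.Nat.≤ k → (m : ℚ) → 1ℚ < m →
    ((∀ (A : OnlineAlg) (ρ : ℚ) → ρ * (m + 1ℚ) < 2ℚ * m → ¬ Competitive k m A ρ)
     × (2ℚ * m < 2ℚ * (m + 1ℚ)))
corollary2 k 2≤k m 1<m =
  (λ A ρ ρ[m+1]<2m competitive →
     <-irrefl refl (<-≤-trans ρ[m+1]<2m
       (competitive⇒ratio-bound (ℕ.<⇒≤ 2≤k) 1<m A ρ competitive)))
  , *-monoʳ-<-pos 2ℚ {{positive 0<2}} (subst (_< m + 1ℚ) (+-identityʳ m) (+-monoʳ-< m 0<1))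
  where
  0<2 : 0ℚ < 2ℚ
  0<2 = <-trans 0<1 (subst (_< 2ℚ) (+-identityʳ 1ℚ) (+-monoʳ-< 1ℚ 0<1))
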